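{- Let $p$ be a prime and let $S\ge s\ge 0$ be integers. Let $$I_{S,s}=\{f\in\mathbb{Z}[x]: p^s\mid f(n)\text{ for all }n\in\mathbb{Z},\text{ and }p^S\mid f(0)\},$$ an ideal of $\mathbb{Z}[x]$, and let $R_{S,s}=\mathbb{Z}[x]/I_{S,s}$. Then $|R_{S,s}|=p^{S-s+B(s)}$.
   Context: For a nonzero integer $a$, $v(a)$ is the exponent of $p$ in $a$. Define $\alpha(j)=v(j!)=\sum_{i\ge1}\lfloor j/p^i\rfloor$ for integers $j\ge0$, $\beta(m)=\min\{j\ge0:\alpha(j)\ge m\}$ for integers $m\ge 0$, and $B(s)=\sum_{m=1}^s\beta(m)$. -}

module Defs where

open import Data.Nat as ℕ using (ℕ; zero; suc; _+_; _*_; _^_; _≤_; _≥_; _≤?_; NonZero)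
open import Data.Nat.DivMod using (_/_)
open import Data.Nat.Properties using (m^n≢0)
open import Data.Integer as ℤ using (ℤ)
open import Data.Integer.Divisibility using () renaming (_∣_ to _∣ℤ_)
open import Data.List using (List; []; _∷_)
open import Data.Fin using (Fin)
open import Data.Product using (Σ; ∃; _×_)
open import Relation.Nullary using (yes; no)
open import Relation.Binary.PropositionalEquality using (_≡_)

sum1 : ℕ → (ℕ → ℕ) → ℕ
sum1 zero    f = 0
sum1 (suc k) f = sum1 k f + f (suc k)

-- α(j) = v_p(j!) = Σ_{i≥1} ⌊j/p^i⌋ ; terms with i > j vanish since p^i > j,
-- so the sum over 1 ≤ i ≤ j is the full sum.
α : (p : ℕ) .{{_ : NonZero p}} → ℕ → ℕ
α p j = sum1 j (λ i → _/_ j (p ^ i) {{m^n≢0 p i}})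

-- least j' in [j, j + fuel] with α(j') ≥ m (returns j + fuel if none)
search : (p : ℕ) .{{_ : NonZero p}} → ℕ → ℕ → ℕ → ℕ
search p m j zero = j
search p m j (suc fuel) with m ≤? α p j
... | yes _ = j
... | no  _ = search p m (suc j) fuel

-- β(m) = min { j ≥ 0 : α(j) ≥ m }; since α(p·m) ≥ m, search up to p·m suffices.
β : (p : ℕ) .{{_ : NonZero p}} → ℕ → ℕ
β p m = search p m 0 (p * m)

B : (p : ℕ) .{{_ : NonZero p}} → ℕ → ℕ
B p s = sum1 s (β p)

-- Integer polynomials as coefficient lists, constant term first.
Poly : Set
Poly = List ℤ

eval : Poly → ℤ → ℤ
eval []       n = ℤ.0ℤ
eval (a ∷ as) n = a ℤ.+ n ℤ.* eval as n

_-ₚ_ : Poly → Poly → Poly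
[]       -ₚ []       = []
[]       -ₚ (b ∷ bs) = ℤ.- b ∷ ([] -ₚ bs)
(a ∷ as) -ₚ []       = a ∷ as
(a ∷ as) -ₚ (b ∷ bs) = (a ℤ.- b) ∷ (as -ₚ bs)

InI : (p S s : ℕ) → Poly → Set
InI p S s f = ((n : ℤ) → ℤ.+ (p ^ s) ∣ℤ eval f n) × (ℤ.+ (p ^ S) ∣ℤ eval f ℤ.0ℤ)

-- congruence modulo I_{S,s}: the equivalence whose classes form R_{S,s}
_≈[_,_,_]_ : Poly → ℕ → ℕ → ℕ → Poly → Set
f ≈[ p , S , s ] g = InI p S s (f -ₚ g)

HasCard : (A : Set) → (A → A → Set) → ℕ → Set
HasCard A _~_ n = Σ (Fin n → A) λ e →
  ((a : A) → ∃ λ i → e i ~ a) × ((i j : Fin n) → e i ~ e j → i ≡ j)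

module Submission where

-- Write an integer polynomial in the falling-factorial basis x^(k) = x(x-1)⋯(x-k+1):
-- f = Σ cₖ x^(k) with integer cₖ, and every such combination is an integer polynomial.
-- Forward differences show that p^s divides f(n) for every n ∈ ℤ iff p^s ∣ cₖ · k! for
-- all k, and f(0) = c₀.  Legendre's formula k! = p^{α(k)} · (unit) turns this into:
-- f ∈ I_{S,s} iff p^{E k} ∣ cₖ for all k, where E 0 = S and E k = s ∸ α(k) for k ≥ 1,
-- which vanishes for k > p·s because α(p·s) ≥ s.  So the classes are represented exactly
-- once by Σ_{k ≤ ps} dₖ x^(k) with 0 ≤ dₖ < p^{E k}, and there are
-- p^{S + Σ_{k=1}^{ps} (s ∸ α k)} of them; double counting the pairs (k, m) with
-- α(k) < m ≤ s identifies the exponent with S - s + B(s).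

open import Data.Nat using (ℕ; NonZero; _≤_)
open import Data.Nat.Primality using (Prime)

module Coefficients where
  open import Data.Nat using (ℕ; zero; suc)
  open import Data.Integer using (ℤ; 0ℤ; _+_; _-_; _*_; -_; _^_)
  open import Data.Integer.Properties using (+-identityˡ; +-identityʳ; *-zeroʳ; *-identityʳ)
  open import Data.Integer.Divisibility.Signed using (_∣_; divides; ∣m∣n⇒∣m+n)
  open import Data.Integer.Tactic.RingSolver using (solve-∀)
  open import Data.List using (List; []; _∷_)
  open import Function using (_∘_; const)
  open import Relation.Binary.PropositionalEquality
  open import Defs using (Poly; eval; _-ₚ_)

  lin : (ℕ → ℤ) → List ℤ → ℤ
  lin φ []       = 0ℤ
  lin φ (c ∷ cs) = c * φ 0 + lin (φ ∘ suc) cs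

  coeff : List ℤ → ℕ → ℤ
  coeff []       j       = 0ℤ
  coeff (c ∷ cs) zero    = c
  coeff (c ∷ cs) (suc j) = coeff cs j

  _⊕_ : List ℤ → List ℤ → List ℤ
  []       ⊕ ds       = ds
  (c ∷ cs) ⊕ []       = c ∷ cs
  (c ∷ cs) ⊕ (d ∷ ds) = (c + d) ∷ (cs ⊕ ds)

  weight : (ℕ → ℤ) → List ℤ → List ℤ
  weight a []       = []
  weight a (c ∷ cs) = c * a 0 ∷ weight (a ∘ suc) cs

  scale : ℤ → List ℤ → List ℤ
  scale a = weight (const a)

  lin-⊕ : ∀ φ cs ds → lin φ (cs ⊕ ds) ≡ lin φ cs + lin φ ds
  lin-⊕ φ []       ds       = sym (+-identityˡ _)
  lin-⊕ φ (c ∷ cs) []       = sym (+-identityʳ _)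
  lin-⊕ φ (c ∷ cs) (d ∷ ds) =
    trans (cong ((c + d) * φ 0 +_) (lin-⊕ (φ ∘ suc) cs ds))
          (distrib c d (φ 0) (lin (φ ∘ suc) cs) (lin (φ ∘ suc) ds))
    where
    distrib : ∀ c d x u v → (c + d) * x + (u + v) ≡ (c * x + u) + (d * x + v)
    distrib = solve-∀

  lin--ₚ : ∀ φ cs ds → lin φ (cs -ₚ ds) ≡ lin φ cs - lin φ ds
  lin--ₚ φ []       []       = refl
  lin--ₚ φ []       (d ∷ ds) =
    trans (cong ((- d) * φ 0 +_) (lin--ₚ (φ ∘ suc) [] ds)) (negate d (φ 0) (lin (φ ∘ suc) ds))
    where
    negate : ∀ d x v → (- d) * x + (0ℤ - v) ≡ 0ℤ - (d * x + v)
    negate = solve-∀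
  lin--ₚ φ (c ∷ cs) []       = sym (+-identityʳ _)
  lin--ₚ φ (c ∷ cs) (d ∷ ds) =
    trans (cong ((c - d) * φ 0 +_) (lin--ₚ (φ ∘ suc) cs ds))
          (distrib c d (φ 0) (lin (φ ∘ suc) cs) (lin (φ ∘ suc) ds))
    where
    distrib : ∀ c d x u v → (c - d) * x + (u - v) ≡ (c * x + u) - (d * x + v)
    distrib = solve-∀

  lin-weight : ∀ φ a cs → lin φ (weight a cs) ≡ lin (λ i → a i * φ i) cs
  lin-weight φ a []       = refl
  lin-weight φ a (c ∷ cs) =
    cong₂ _+_ (reassoc c (a 0) (φ 0)) (lin-weight (φ ∘ suc) (a ∘ suc) cs)
    where
    reassoc : ∀ c a x → (c * a) * x ≡ c * (a * x)
    reassoc = solve-∀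

  lin-cong : ∀ {φ ψ} cs → (∀ i → φ i ≡ ψ i) → lin φ cs ≡ lin ψ cs
  lin-cong []       eq = refl
  lin-cong (c ∷ cs) eq = cong₂ _+_ (cong (c *_) (eq 0)) (lin-cong cs (eq ∘ suc))

  lin-+ : ∀ φ ψ cs → lin (λ i → φ i + ψ i) cs ≡ lin φ cs + lin ψ cs
  lin-+ φ ψ []       = refl
  lin-+ φ ψ (c ∷ cs) =
    trans (cong (c * (φ 0 + ψ 0) +_) (lin-+ (φ ∘ suc) (ψ ∘ suc) cs))
          (distrib c (φ 0) (ψ 0) (lin (φ ∘ suc) cs) (lin (ψ ∘ suc) cs))
    where
    distrib : ∀ c x y u v → c * (x + y) + (u + v) ≡ (c * x + u) + (c * y + v)
    distrib = solve-∀

  lin-* : ∀ a φ cs → lin (λ i → a * φ i) cs ≡ a * lin φ cs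
  lin-* a φ []       = sym (*-zeroʳ a)
  lin-* a φ (c ∷ cs) =
    trans (cong (c * (a * φ 0) +_) (lin-* a (φ ∘ suc) cs)) (distrib a c (φ 0) (lin (φ ∘ suc) cs))
    where
    distrib : ∀ a c x u → c * (a * x) + a * u ≡ a * (c * x + u)
    distrib = solve-∀

  coeff--ₚ : ∀ cs ds j → coeff (cs -ₚ ds) j ≡ coeff cs j - coeff ds j
  coeff--ₚ []       []       j       = refl
  coeff--ₚ []       (d ∷ ds) zero    = sym (+-identityˡ (- d))
  coeff--ₚ []       (d ∷ ds) (suc j) = coeff--ₚ [] ds j
  coeff--ₚ (c ∷ cs) []       zero    = sym (+-identityʳ c)
  coeff--ₚ (c ∷ cs) []       (suc j) = sym (+-identityʳ _)
  coeff--ₚ (c ∷ cs) (d ∷ ds) zero    = refl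
  coeff--ₚ (c ∷ cs) (d ∷ ds) (suc j) = coeff--ₚ cs ds j

  coeff-weight : ∀ a cs j → coeff (weight a cs) j ≡ coeff cs j * a j
  coeff-weight a []       j       = refl
  coeff-weight a (c ∷ cs) zero    = refl
  coeff-weight a (c ∷ cs) (suc j) = coeff-weight (a ∘ suc) cs j

  lin-divisible : ∀ {m} φ cs → (∀ j → m ∣ coeff cs j * φ j) → m ∣ lin φ cs
  lin-divisible φ []       h = divides 0ℤ refl
  lin-divisible φ (c ∷ cs) h = ∣m∣n⇒∣m+n (h 0) (lin-divisible (φ ∘ suc) cs (h ∘ suc))

  -- Horner evaluation of a polynomial is its value in the monomial basis,
  -- so evaluation inherits the linearity of lin.
  eval-lin : ∀ f x → eval f x ≡ lin (x ^_) f
  eval-lin []      x = refl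
  eval-lin (a ∷ f) x =
    cong₂ _+_ (sym (*-identityʳ a)) (trans (cong (x *_) (eval-lin f x)) (sym (lin-* x (x ^_) f)))

  eval-⊕ : ∀ f g x → eval (f ⊕ g) x ≡ eval f x + eval g x
  eval-⊕ f g x = trans (eval-lin (f ⊕ g) x)
    (trans (lin-⊕ (x ^_) f g) (sym (cong₂ _+_ (eval-lin f x) (eval-lin g x))))

  eval--ₚ : ∀ f g x → eval (f -ₚ g) x ≡ eval f x - eval g x
  eval--ₚ f g x = trans (eval-lin (f -ₚ g) x)
    (trans (lin--ₚ (x ^_) f g) (sym (cong₂ _-_ (eval-lin f x) (eval-lin g x))))

  eval-scale : ∀ a f x → eval (scale a f) x ≡ a * eval f x
  eval-scale a f x = trans (eval-lin (scale a f) x)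
    (trans (lin-weight (x ^_) (const a) f) (trans (lin-* a (x ^_) f) (cong (a *_) (sym (eval-lin f x)))))

  linPoly : (ℕ → Poly) → List ℤ → Poly
  linPoly P []       = []
  linPoly P (c ∷ cs) = scale c (P 0) ⊕ linPoly (P ∘ suc) cs

  eval-linPoly : ∀ P cs x → eval (linPoly P cs) x ≡ lin (λ i → eval (P i) x) cs
  eval-linPoly P []       x = refl
  eval-linPoly P (c ∷ cs) x =
    trans (eval-⊕ (scale c (P 0)) (linPoly (P ∘ suc) cs) x)
          (cong₂ _+_ (eval-scale c (P 0) x) (eval-linPoly (P ∘ suc) cs x))

module FallingFactorial where
  open import Data.Nat using (ℕ; zero; suc; _!)
  open import Data.Integer using (ℤ; +_; -[1+_]; 0ℤ; 1ℤ; _+_; _-_; _*_; -_)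
    renaming (suc to 1+_)
  open import Data.Integer.Properties using (+-identityˡ; +-identityʳ; +-assoc; *-identityʳ; *-zeroʳ; pos-*; *-assoc)
  open import Data.Integer.Divisibility.Signed
    using (_∣_; divides; ∣-refl; ∣-trans; ∣m∣n⇒∣m+n; ∣m∣n⇒∣m-n; *-monoʳ-∣)
  open import Data.Integer.Tactic.RingSolver using (solve-∀)
  open import Data.List using (List; []; _∷_)
  open import Function using (_∘_; const)
  open import Relation.Binary.PropositionalEquality
  open import Defs using (Poly; eval; _-ₚ_)
  open Coefficients

  ℤ-induction : (P : ℤ → Set) → P 0ℤ → (∀ x → P x → P (1+ x)) → (∀ x → P (1+ x) → P x) →
                ∀ x → P x
  ℤ-induction P base up down (+ zero)       = base
  ℤ-induction P base up down (+ suc n)      = up (+ n) (ℤ-induction P base up down (+ n))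
  ℤ-induction P base up down -[1+ zero ]    = down -[1+ zero ] base
  ℤ-induction P base up down -[1+ suc n ]   = down -[1+ suc n ] (ℤ-induction P base up down -[1+ n ])

  fall : ℤ → ℕ → ℤ
  fall x zero    = 1ℤ
  fall x (suc k) = fall x k * (x - + k)

  fall-0 : ∀ k → fall 0ℤ (suc k) ≡ 0ℤ
  fall-0 zero    = refl
  fall-0 (suc k) = cong (_* (0ℤ - + suc k)) (fall-0 k)

  fall-Δ : ∀ x k → fall (1+ x) (suc k) ≡ fall x (suc k) + + suc k * fall x k
  fall-Δ x zero    = first x
    where
    first : ∀ x → 1ℤ * ((1ℤ + x) - 0ℤ) ≡ 1ℤ * (x - 0ℤ) + 1ℤ * 1ℤ
    first = solve-∀
  fall-Δ x (suc k) =
    trans (cong (_* ((1ℤ + x) - + suc k)) (fall-Δ x k)) (step (fall x k) x (+ k))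
    where
    step : ∀ F x k → (F * (x - k) + (1ℤ + k) * F) * ((1ℤ + x) - (1ℤ + k))
                     ≡ F * (x - k) * (x - (1ℤ + k)) + (1ℤ + (1ℤ + k)) * (F * (x - k))
    step = solve-∀

  fall-x : ∀ x k → x * fall x k ≡ fall x (suc k) + + k * fall x k
  fall-x x k = expand (fall x k) x (+ k)
    where
    expand : ∀ F x k → x * F ≡ F * (x - k) + k * F
    expand = solve-∀

  -- k! divides x^(k) for every integer x: induction on k, then on x via fall-Δ.
  fall-divisible : ∀ k x → + (k !) ∣ fall x k
  fall-divisible zero    x = ∣-refl
  fall-divisible (suc k) = ℤ-induction (λ x → + (suc k !) ∣ fall x (suc k))
    (subst (m ∣_) (sym (fall-0 k)) (divides 0ℤ refl))
    (λ x d → subst (m ∣_) (sym (fall-Δ x k)) (∣m∣n⇒∣m+n d (difference x)))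
    (λ x d → subst (m ∣_) (cancel (fall x (suc k)) _)
                       (∣m∣n⇒∣m-n (subst (m ∣_) (fall-Δ x k) d) (difference x)))
    where
    m : ℤ
    m = + (suc k !)
    difference : ∀ x → m ∣ + suc k * fall x k
    difference x =
      subst (_∣ + suc k * fall x k) (sym (pos-* (suc k) (k !))) (*-monoʳ-∣ (+ suc k) (fall-divisible k x))
    cancel : ∀ a b → (a + b) - b ≡ a
    cancel = solve-∀

  -- Coefficients of x · Σ cₖ x^(k) = Σ cₖ (x^(k+1) + k x^(k)).
  timesX : List ℤ → List ℤ
  timesX cs = (0ℤ ∷ cs) ⊕ weight +_ cs

  lin-timesX : ∀ x cs → lin (fall x) (timesX cs) ≡ x * lin (fall x) cs
  lin-timesX x cs = begin
    lin (fall x) ((0ℤ ∷ cs) ⊕ weight +_ cs)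
      ≡⟨ lin-⊕ (fall x) (0ℤ ∷ cs) (weight +_ cs) ⟩
    (0ℤ * 1ℤ + lin (fall x ∘ suc) cs) + lin (fall x) (weight +_ cs)
      ≡⟨ cong₂ _+_ (+-identityˡ (lin (fall x ∘ suc) cs)) (lin-weight (fall x) +_ cs) ⟩
    lin (fall x ∘ suc) cs + lin (λ k → + k * fall x k) cs
      ≡⟨ sym (lin-+ (fall x ∘ suc) (λ k → + k * fall x k) cs) ⟩
    lin (λ k → fall x (suc k) + + k * fall x k) cs
      ≡⟨ lin-cong cs (λ k → sym (fall-x x k)) ⟩
    lin (λ k → x * fall x k) cs
      ≡⟨ lin-* x (fall x) cs ⟩
    x * lin (fall x) cs ∎
    where open ≡-Reasoning

  record Expansion (f : Poly) (cs : List ℤ) : Set where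
    constructor expansion
    field value : ∀ x → eval f x ≡ lin (fall x) cs
  open Expansion public

  expansion--ₚ : ∀ {f g cs ds} → Expansion f cs → Expansion g ds → Expansion (f -ₚ g) (cs -ₚ ds)
  expansion--ₚ {f} {g} {cs} {ds} ef eg = expansion λ x →
    trans (eval--ₚ f g x) (trans (cong₂ _-_ (value ef x) (value eg x)) (sym (lin--ₚ (fall x) cs ds)))

  -- Every integer polynomial has integer falling-factorial coefficients (Horner's scheme).
  toFall : Poly → List ℤ
  toFall []      = []
  toFall (a ∷ f) = (a ∷ []) ⊕ timesX (toFall f)

  lin-toFall : ∀ f x → lin (fall x) (toFall f) ≡ eval f x
  lin-toFall []      x = refl
  lin-toFall (a ∷ f) x = begin
    lin (fall x) ((a ∷ []) ⊕ timesX (toFall f))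
      ≡⟨ lin-⊕ (fall x) (a ∷ []) (timesX (toFall f)) ⟩
    (a * 1ℤ + 0ℤ) + lin (fall x) (timesX (toFall f))
      ≡⟨ cong₂ _+_ (unit a) (lin-timesX x (toFall f)) ⟩
    a + x * lin (fall x) (toFall f)
      ≡⟨ cong (λ e → a + x * e) (lin-toFall f x) ⟩
    a + x * eval f x ∎
    where
    open ≡-Reasoning
    unit : ∀ a → a * 1ℤ + 0ℤ ≡ a
    unit = solve-∀

  toFall-expansion : ∀ f → Expansion f (toFall f)
  toFall-expansion f = expansion λ x → sym (lin-toFall f x)

  -- x^(k) as a polynomial, using x^(k+1) = x · x^(k) - k x^(k).
  fallPoly : ℕ → Poly
  fallPoly zero    = 1ℤ ∷ []
  fallPoly (suc k) = (0ℤ ∷ fallPoly k) ⊕ scale (- + k) (fallPoly k)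

  eval-fallPoly : ∀ k x → eval (fallPoly k) x ≡ fall x k
  eval-fallPoly zero    x = constant x
    where
    constant : ∀ x → 1ℤ + x * 0ℤ ≡ 1ℤ
    constant = solve-∀
  eval-fallPoly (suc k) x =
    trans (eval-⊕ (0ℤ ∷ fallPoly k) (scale (- + k) (fallPoly k)) x)
          (trans (cong₂ (λ e e′ → (0ℤ + x * e) + e′) (eval-fallPoly k x)
                         (trans (eval-scale (- + k) (fallPoly k) x) (cong (- + k *_) (eval-fallPoly k x))))
                 (expand (fall x k) x (+ k)))
    where
    expand : ∀ F x k → (0ℤ + x * F) + (- k) * F ≡ F * (x - k)
    expand = solve-∀

  fromFall : List ℤ → Poly
  fromFall = linPoly fallPoly

  fromFall-expansion : ∀ cs → Expansion (fromFall cs) cs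
  fromFall-expansion cs = expansion λ x →
    trans (eval-linPoly fallPoly cs x) (lin-cong cs (λ k → eval-fallPoly k x))

  -- Coefficients of the forward difference: Δ (Σ cₖ x^(k)) = Σ (k+1) c_{k+1} x^(k).
  Δcoeffs : List ℤ → List ℤ
  Δcoeffs []       = []
  Δcoeffs (c ∷ cs) = weight (λ k → + suc k) cs

  lin-Δ : ∀ x cs → lin (fall (1+ x)) cs ≡ lin (fall x) cs + lin (fall x) (Δcoeffs cs)
  lin-Δ x []       = refl
  lin-Δ x (c ∷ cs) = begin
    c * 1ℤ + lin (fall (1+ x) ∘ suc) cs
      ≡⟨ cong (_+_ (c * 1ℤ)) (lin-cong cs (fall-Δ x)) ⟩
    c * 1ℤ + lin (λ k → fall x (suc k) + + suc k * fall x k) cs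
      ≡⟨ cong (_+_ (c * 1ℤ)) (lin-+ (fall x ∘ suc) (λ k → + suc k * fall x k) cs) ⟩
    c * 1ℤ + (lin (fall x ∘ suc) cs + lin (λ k → + suc k * fall x k) cs)
      ≡⟨ +-assoc (c * 1ℤ) _ _ ⟨
    (c * 1ℤ + lin (fall x ∘ suc) cs) + lin (λ k → + suc k * fall x k) cs
      ≡⟨ cong (λ e → lin (fall x) (c ∷ cs) + e) (lin-weight (fall x) (λ k → + suc k) cs) ⟨
    lin (fall x) (c ∷ cs) + lin (fall x) (Δcoeffs (c ∷ cs)) ∎
    where open ≡-Reasoning

  lin-at-0 : ∀ cs → lin (fall 0ℤ) cs ≡ coeff cs 0
  lin-at-0 []       = refl
  lin-at-0 (c ∷ cs) =
    trans (cong (_+_ (c * 1ℤ)) (trans (lin-cong cs fall-0) (vanish cs))) (unit c)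
    where
    vanish : ∀ cs → lin (const 0ℤ) cs ≡ 0ℤ
    vanish []       = refl
    vanish (c ∷ cs) = trans (cong (_+_ (c * 0ℤ)) (vanish cs)) (trans (+-identityʳ _) (*-zeroʳ c))
    unit : ∀ c → c * 1ℤ + 0ℤ ≡ c
    unit c = trans (+-identityʳ _) (*-identityʳ c)

  values-divisible⇒ : ∀ {m} cs → (∀ x → m ∣ lin (fall x) cs) → ∀ k → m ∣ coeff cs k * + (k !)
  values-divisible⇒ {m} cs       h zero    = subst (m ∣_) (trans (lin-at-0 cs) (sym (*-identityʳ _))) (h 0ℤ)
  values-divisible⇒ {m} []       h (suc k) = divides 0ℤ refl
  values-divisible⇒ {m} (c ∷ cs) h (suc k) =
    subst (m ∣_) rescale (values-divisible⇒ (Δcoeffs (c ∷ cs)) differences k)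
    where
    differences : ∀ x → m ∣ lin (fall x) (Δcoeffs (c ∷ cs))
    differences x = subst (m ∣_) (difference (lin-Δ x (c ∷ cs))) (∣m∣n⇒∣m-n (h (1+ x)) (h x))
      where
      difference : ∀ {a b d} → a ≡ b + d → a - b ≡ d
      difference {b = b} {d} refl = cancel b d
        where
        cancel : ∀ b d → (b + d) - b ≡ d
        cancel = solve-∀
    rescale : coeff (Δcoeffs (c ∷ cs)) k * + (k !) ≡ coeff cs k * + (suc k !)
    rescale = begin
      coeff (weight (λ k → + suc k) cs) k * + (k !) ≡⟨ cong (_* + (k !)) (coeff-weight _ cs k) ⟩
      (coeff cs k * + suc k) * + (k !)              ≡⟨ *-assoc (coeff cs k) _ _ ⟩
      coeff cs k * (+ suc k * + (k !))               ≡⟨ cong (coeff cs k *_) (pos-* (suc k) (k !)) ⟨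
      coeff cs k * + (suc k !)                       ∎
      where open ≡-Reasoning

  values-divisible⇐ : ∀ {m} cs → (∀ k → m ∣ coeff cs k * + (k !)) → ∀ x → m ∣ lin (fall x) cs
  values-divisible⇐ cs h x =
    lin-divisible (fall x) cs (λ k → ∣-trans (h k) (*-monoʳ-∣ (coeff cs k) (fall-divisible k x)))

module Counting where
  open import Data.Nat
  open import Data.Nat.Properties
  open import Data.Nat.DivMod
  open import Data.Nat.Divisibility
  open import Data.Nat.Tactic.RingSolver using (solve-∀)
  open import Data.Empty using (⊥-elim)
  open import Relation.Nullary using (Dec; yes; no)
  open import Relation.Binary.PropositionalEquality
  open import Defs using (sum1)

  indicator : ∀ {a} {A : Set a} → Dec A → ℕ
  indicator (yes _) = 1
  indicator (no _)  = 0

  indicator-cong : ∀ {A B : Set} → (A → B) → (B → A) → (a : Dec A) (b : Dec B) →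
                   indicator a ≡ indicator b
  indicator-cong f g (yes a) (yes b) = refl
  indicator-cong f g (yes a) (no ¬b) = ⊥-elim (¬b (f a))
  indicator-cong f g (no ¬a) (yes b) = ⊥-elim (¬a (g b))
  indicator-cong f g (no ¬a) (no ¬b) = refl

  sum1-cong : ∀ k {f g} → (∀ i → 1 ≤ i → i ≤ k → f i ≡ g i) → sum1 k f ≡ sum1 k g
  sum1-cong zero    eq = refl
  sum1-cong (suc k) eq =
    cong₂ _+_ (sum1-cong k (λ i 1≤i i≤k → eq i 1≤i (m≤n⇒m≤1+n i≤k))) (eq (suc k) (s≤s z≤n) ≤-refl)

  sum1-zero : ∀ k → sum1 k (λ _ → 0) ≡ 0
  sum1-zero zero    = refl
  sum1-zero (suc k) = trans (+-identityʳ _) (sum1-zero k)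

  sum1-+ : ∀ k f g → sum1 k (λ i → f i + g i) ≡ sum1 k f + sum1 k g
  sum1-+ zero    f g = refl
  sum1-+ (suc k) f g =
    trans (cong (_+ (f (suc k) + g (suc k))) (sum1-+ k f g))
          (interchange (sum1 k f) (sum1 k g) (f (suc k)) (g (suc k)))
    where
    interchange : ∀ a b c d → (a + b) + (c + d) ≡ (a + c) + (b + d)
    interchange = solve-∀

  sum1-shift : ∀ k f → sum1 (suc k) f ≡ f 1 + sum1 k (λ i → f (suc i))
  sum1-shift zero    f = sym (+-identityʳ (f 1))
  sum1-shift (suc k) f =
    trans (cong (_+ f (suc (suc k))) (sum1-shift k f)) (+-assoc (f 1) _ _)

  sum1-≥-first : ∀ k f → 1 ≤ k → f 1 ≤ sum1 k f
  sum1-≥-first (suc k) f _ = subst (f 1 ≤_) (sym (sum1-shift k f)) (m≤m+n (f 1) _)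

  count-≤ : ∀ k v → sum1 k (λ i → indicator (i ≤? v)) ≡ k ⊓ v
  count-≤ zero    v = refl
  count-≤ (suc k) v with suc k ≤? v
  ... | yes k<v = begin
    sum1 k _ + 1 ≡⟨ cong (_+ 1) (trans (count-≤ k v) (m≤n⇒m⊓n≡m (<⇒≤ k<v))) ⟩
    k + 1        ≡⟨ +-comm k 1 ⟩
    suc k        ≡⟨ m≤n⇒m⊓n≡m k<v ⟨
    suc k ⊓ v    ∎
    where open ≡-Reasoning
  ... | no k≮v = begin
    sum1 k _ + 0 ≡⟨ +-identityʳ _ ⟩
    sum1 k _     ≡⟨ trans (count-≤ k v) (m≥n⇒m⊓n≡n v≤k) ⟩
    v            ≡⟨ m≥n⇒m⊓n≡n (m≤n⇒m≤1+n v≤k) ⟨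
    suc k ⊓ v    ∎
    where
    open ≡-Reasoning
    v≤k : v ≤ k
    v≤k = ≤-pred (≰⇒> k≮v)

  ∸-suc : ∀ s a → suc s ∸ a ≡ (s ∸ a) + indicator (a ≤? s)
  ∸-suc s a with a ≤? s
  ... | yes a≤s = trans (+-∸-assoc 1 a≤s) (+-comm 1 (s ∸ a))
  ... | no  a≰s = trans (m≤n⇒m∸n≡0 (≰⇒> a≰s)) (sym (cong (_+ 0) (m≤n⇒m∸n≡0 (<⇒≤ (≰⇒> a≰s)))))

  floor-suc : ∀ q .{{_ : NonZero q}} j → suc j / q ≡ j / q + indicator (q ∣? suc j)
  floor-suc q j =
    subst (λ x → suc x / q ≡ x / q + indicator (q ∣? suc x)) (sym (m≡m%n+[m/n]*n j q))
          (split (j % q) (j / q) (m%n<n j q))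
    where
    floor-exact : ∀ r a → r < q → (r + a * q) / q ≡ a
    floor-exact r a r<q = trans (+-distrib-/-∣ʳ r (divides a refl)) (cong₂ _+_ (m<n⇒m/n≡0 r<q) (m*n/n≡m a q))
    split : ∀ r a → r < q → suc (r + a * q) / q ≡ (r + a * q) / q + indicator (q ∣? suc (r + a * q))
    split r a r<q rewrite floor-exact r a r<q with suc r ≟ q | q ∣? suc (r + a * q)
    ... | yes r+1≡q | yes _ = begin
      suc (r + a * q) / q ≡⟨ /-congˡ (cong (_+ a * q) r+1≡q) ⟩
      (suc a * q) / q     ≡⟨ m*n/n≡m (suc a) q ⟩
      suc a               ≡⟨ +-comm 1 a ⟩
      a + 1               ∎
      where open ≡-Reasoning
    ... | yes r+1≡q | no q∤ = ⊥-elim (q∤ (divides (suc a) (cong (_+ a * q) r+1≡q)))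
    ... | no r+1≢q | yes q∣ =
      ⊥-elim (<⇒≱ (≤∧≢⇒< r<q r+1≢q)
                  (∣⇒≤ (∣m+n∣m⇒∣n (subst (q ∣_) (+-comm (suc r) (a * q)) q∣) (n∣m*n a))))
    ... | no r+1≢q | no _ = trans (floor-exact (suc r) a (≤∧≢⇒< r<q r+1≢q)) (sym (+-identityʳ a))

module Legendre (p : ℕ) .{{_ : NonZero p}} (p-prime : Prime p) where
  open import Data.Nat
  open import Data.Nat.Properties
  open import Data.Nat.DivMod
  open import Data.Nat.Divisibility
  open import Data.Nat.Induction using (<-wellFounded)
  open import Data.Nat.Primality using (euclidsLemma; prime⇒nonTrivial)
  open import Data.Nat.Tactic.RingSolver using (solve-∀)
  open import Induction.WellFounded using (Acc; acc)
  open import Data.Product using (Σ-syntax; _×_; _,_)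
  open import Data.Sum using (inj₁; inj₂; [_,_])
  open import Data.Empty using (⊥-elim)
  open import Relation.Nullary using (¬_; yes; no)
  open import Relation.Binary.PropositionalEquality hiding ([_])
  open import Defs using (α; β; B; search; sum1)
  open Counting

  1<p : 1 < p
  1<p = nonTrivial⇒n>1 p {{prime⇒nonTrivial p-prime}}

  p^-∣ : ∀ {a b} → a ≤ b → p ^ a ∣ p ^ b
  p^-∣ {a} {b} a≤b =
    divides (p ^ (b ∸ a)) (trans (cong (p ^_) (sym (m∸n+n≡m a≤b))) (^-distribˡ-+-* p (b ∸ a) a))

  n<p^n : ∀ n → n < p ^ n
  n<p^n zero    = s≤s z≤n
  n<p^n (suc n) = begin-strict
    suc n     ≤⟨ n<p^n n ⟩
    p ^ n     <⟨ m<m*n (p ^ n) p {{m^n≢0 p n}} 1<p ⟩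
    p ^ n * p ≡⟨ *-comm (p ^ n) p ⟩
    p ^ suc n ∎
    where open ≤-Reasoning

  record PPart (n : ℕ) : Set where
    constructor pPart
    field
      v w  : ℕ
      n≡   : n ≡ p ^ v * w
      p∤w  : ¬ p ∣ w

  p-part : ∀ n → 0 < n → PPart n
  p-part n = go n (<-wellFounded n)
    where
    times-p : ∀ q → PPart q → PPart (q * p)
    times-p q (pPart v w q≡ p∤w) =
      pPart (suc v) w (trans (cong (_* p) q≡) (reorder (p ^ v) w p)) p∤w
      where
      reorder : ∀ a b c → (a * b) * c ≡ (c * a) * b
      reorder = solve-∀
    go : ∀ n → Acc _<_ n → 0 < n → PPart n
    go n (acc smaller) 0<n with p ∣? n
    ... | no  p∤n = pPart 0 n (sym (+-identityʳ n)) p∤n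
    ... | yes (divides zero    refl) = ⊥-elim (<-irrefl refl 0<n)
    ... | yes (divides (suc q) refl) =
      times-p (suc q) (go (suc q) (smaller (m<m*n (suc q) p 1<p)) (s≤s z≤n))

  -- the exponent of the p-part is below n (w ≠ 0 because p ∣ 0)
  exponent<n : ∀ {n} (pp : PPart n) → PPart.v pp < n
  exponent<n (pPart v zero    n≡ p∤w) = ⊥-elim (p∤w (p ∣0))
  exponent<n (pPart v (suc w) n≡ p∤w) =
    <-≤-trans (n<p^n v) (subst (p ^ v ≤_) (sym n≡) (m≤m*n (p ^ v) (suc w)))

  infixl 7 _/p^_
  _/p^_ : ℕ → ℕ → ℕ
  j /p^ i = _/_ j (p ^ i) {{m^n≢0 p i}}

  p^-∣-p-part : ∀ v w i → ¬ p ∣ w → indicator (p ^ i ∣? p ^ v * w) ≡ indicator (i ≤? v)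
  p^-∣-p-part v w i p∤w = indicator-cong exponent-≤ (λ i≤v → ∣-trans (p^-∣ i≤v) (m∣m*n w)) _ _
    where
    exponent-≤ : p ^ i ∣ p ^ v * w → i ≤ v
    exponent-≤ d = ≮⇒≥ λ v<i →
      p∤w (*-cancelˡ-∣ (p ^ v) {{m^n≢0 p v}} (subst (_∣ p ^ v * w) (*-comm p (p ^ v)) (∣-trans (p^-∣ v<i) d)))

  α-suc : ∀ j → (pp : PPart (suc j)) → α p (suc j) ≡ α p j + PPart.v pp
  α-suc j (pPart v w 1+j≡ p∤w) = begin
    sum1 (suc j) (λ i → suc j /p^ i)
      ≡⟨ sum1-cong (suc j) (λ i _ _ → floor-suc (p ^ i) {{m^n≢0 p i}} j) ⟩
    sum1 (suc j) (λ i → j /p^ i + indicator (p ^ i ∣? suc j))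
      ≡⟨ sum1-+ (suc j) _ _ ⟩
    (α p j + j /p^ suc j) + sum1 (suc j) (λ i → indicator (p ^ i ∣? suc j))
      ≡⟨ cong₂ _+_ (cong (α p j +_) last-term) (sum1-cong (suc j) (λ i _ _ → divisible-terms i)) ⟩
    (α p j + 0) + sum1 (suc j) (λ i → indicator (i ≤? v))
      ≡⟨ cong₂ _+_ (+-identityʳ (α p j)) (trans (count-≤ (suc j) v) (m≥n⇒m⊓n≡n v≤1+j)) ⟩
    α p j + v ∎
    where
    open ≡-Reasoning
    last-term : j /p^ suc j ≡ 0
    last-term = m<n⇒m/n≡0 {{m^n≢0 p (suc j)}} (<-trans (n<1+n j) (n<p^n (suc j)))
    divisible-terms : ∀ i → indicator (p ^ i ∣? suc j) ≡ indicator (i ≤? v)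
    divisible-terms i = subst (λ n → indicator (p ^ i ∣? n) ≡ indicator (i ≤? v)) (sym 1+j≡) (p^-∣-p-part v w i p∤w)
    v≤1+j : v ≤ suc j
    v≤1+j = <⇒≤ (exponent<n (pPart v w 1+j≡ p∤w))

  α-≤-suc : ∀ j → α p j ≤ α p (suc j)
  α-≤-suc j = subst (α p j ≤_) (sym (α-suc j pp)) (m≤m+n (α p j) (PPart.v pp))
    where pp = p-part (suc j) (s≤s z≤n)

  α-mono : ∀ {j k} → j ≤ k → α p j ≤ α p k
  α-mono {k = zero} z≤n = ≤-refl
  α-mono {j} {suc k} j≤1+k with m≤n⇒m<n∨m≡n j≤1+k
  ... | inj₁ j<1+k = ≤-trans (α-mono (≤-pred j<1+k)) (α-≤-suc k)
  ... | inj₂ refl  = ≤-refl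

  -- α(p·m) ≥ ⌊p·m/p⌋ = m
  m≤α[p*m] : ∀ m → m ≤ α p (p * m)
  m≤α[p*m] zero    = z≤n
  m≤α[p*m] (suc m) =
    subst (_≤ α p (p * suc m)) first-term
      (sum1-≥-first (p * suc m) (p * suc m /p^_) (>-nonZero⁻¹ (p * suc m) {{m*n≢0 p (suc m)}}))
    where
    first-term : p * suc m /p^ 1 ≡ suc m
    first-term =
      trans (/-congʳ {{m^n≢0 p 1}} (*-identityʳ p)) (trans (/-congˡ (*-comm p (suc m))) (m*n/n≡m (suc m) p))

  factorial-p-part : ∀ j → Σ[ u ∈ ℕ ] (j ! ≡ p ^ α p j * u × ¬ p ∣ u)
  factorial-p-part zero    = 1 , refl , λ p∣1 → <⇒≢ 1<p (sym (∣1⇒≡1 p∣1))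
  factorial-p-part (suc j) with factorial-p-part j | p-part (suc j) (s≤s z≤n)
  ... | u , j!≡ , p∤u | pp@(pPart v w 1+j≡ p∤w) = w * u , product , p∤wu
    where
    reorder : ∀ a b c d → (a * b) * (c * d) ≡ (c * a) * (b * d)
    reorder = solve-∀
    product : suc j * j ! ≡ p ^ α p (suc j) * (w * u)
    product = begin
      suc j * j !                      ≡⟨ cong₂ _*_ 1+j≡ j!≡ ⟩
      (p ^ v * w) * (p ^ α p j * u)    ≡⟨ reorder (p ^ v) w (p ^ α p j) u ⟩
      (p ^ α p j * p ^ v) * (w * u)    ≡⟨ cong (_* (w * u)) (^-distribˡ-+-* p (α p j) v) ⟨
      p ^ (α p j + v) * (w * u)        ≡⟨ cong (λ e → p ^ e * (w * u)) (α-suc j pp) ⟨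
      p ^ α p (suc j) * (w * u)        ∎
      where open ≡-Reasoning
    p∤wu : ¬ p ∣ w * u
    p∤wu p∣wu = [ p∤w , p∤u ] (euclidsLemma w u p-prime p∣wu)

  cancel-unit : ∀ k y u → ¬ p ∣ u → p ^ k ∣ y * u → p ^ k ∣ y
  cancel-unit zero    y u p∤u _ = 1∣ y
  cancel-unit (suc k) y u p∤u d with euclidsLemma y u p-prime (∣-trans (m∣m*n (p ^ k)) d)
  ... | inj₂ p∣u          = ⊥-elim (p∤u p∣u)
  ... | inj₁ (divides y′ refl) =
    subst (p * p ^ k ∣_) (*-comm p y′) (*-monoʳ-∣ p (cancel-unit k y′ u p∤u (*-cancelˡ-∣ p d′)))
    where
    d′ : p * p ^ k ∣ p * (y′ * u)
    d′ = subst (p * p ^ k ∣_) (reorder y′ p u) d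
      where
      reorder : ∀ a b c → (a * b) * c ≡ b * (a * c)
      reorder = solve-∀

  legendre-∣⇒ : ∀ j s x → p ^ s ∣ x * j ! → p ^ (s ∸ α p j) ∣ x
  legendre-∣⇒ j s x d with factorial-p-part j | s ≤? α p j
  ... | _ | yes s≤a rewrite m≤n⇒m∸n≡0 s≤a = 1∣ x
  ... | u , j!≡ , p∤u | no s≰a =
    cancel-unit (s ∸ a) x u p∤u (*-cancelˡ-∣ (p ^ a) {{m^n≢0 p a}} (subst₂ _∣_ split-power regroup d))
    where
    a = α p j
    split-power : p ^ s ≡ p ^ a * p ^ (s ∸ a)
    split-power = trans (cong (p ^_) (sym (m+[n∸m]≡n (<⇒≤ (≰⇒> s≰a))))) (^-distribˡ-+-* p a (s ∸ a))
    regroup : x * j ! ≡ p ^ a * (x * u)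
    regroup = trans (cong (x *_) j!≡) (reorder x (p ^ a) u)
      where
      reorder : ∀ a b c → a * (b * c) ≡ b * (a * c)
      reorder = solve-∀

  legendre-∣⇐ : ∀ j s x → p ^ (s ∸ α p j) ∣ x → p ^ s ∣ x * j !
  legendre-∣⇐ j s x d with factorial-p-part j
  ... | u , j!≡ , _ = subst (p ^ s ∣_) regroup (∣-trans s-part (∣m⇒∣m*n u (*-monoʳ-∣ (p ^ a) d)))
    where
    a = α p j
    s-part : p ^ s ∣ p ^ a * p ^ (s ∸ a)
    s-part = subst (p ^ s ∣_) (^-distribˡ-+-* p a (s ∸ a)) (p^-∣ (m≤n+m∸n s a))
    regroup : (p ^ a * x) * u ≡ x * j !
    regroup = trans (reorder (p ^ a) x u) (cong (x *_) (sym j!≡))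
      where
      reorder : ∀ a b c → (a * b) * c ≡ b * (a * c)
      reorder = solve-∀

  search-least : ∀ m j fuel k → j ≤ k → k < search p m j fuel → α p k < m
  search-least m j zero       k j≤k k<j = ⊥-elim (<-irrefl refl (≤-<-trans j≤k k<j))
  search-least m j (suc fuel) k j≤k k<r with m ≤? α p j
  ... | yes _   = ⊥-elim (<-irrefl refl (≤-<-trans j≤k k<r))
  ... | no  m≰α with m≤n⇒m<n∨m≡n j≤k
  ...   | inj₁ j<k  = search-least m (suc j) fuel k j<k k<r
  ...   | inj₂ refl = ≰⇒> m≰α

  search-found : ∀ m j fuel → m ≤ α p (j + fuel) → m ≤ α p (search p m j fuel)
  search-found m j zero       h = subst (λ k → m ≤ α p k) (+-identityʳ j) h
  search-found m j (suc fuel) h with m ≤? α p j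
  ... | yes m≤α = m≤α
  ... | no  _   = search-found m (suc j) fuel (subst (λ k → m ≤ α p k) (+-suc j fuel) h)

  -- β(m) is the least j with α(j) ≥ m (the search bound p·m suffices by m≤α[p*m])
  β-reaches : ∀ m → m ≤ α p (β p m)
  β-reaches m = search-found m 0 (p * m) (m≤α[p*m] m)

  β-least : ∀ m k → k < β p m → α p k < m
  β-least m k = search-least m 0 (p * m) k z≤n

  -- #{1 ≤ j ≤ J : α j ≤ s} = β(s+1) - 1 when α J > s: since α is monotone,
  -- these j are exactly 1, …, β(s+1) - 1.
  count-α≤ : ∀ s J → suc s ≤ α p J → sum1 J (λ j → indicator (α p j ≤? s)) + 1 ≡ β p (suc s)
  count-α≤ s J s<αJ with β p (suc s) | β-reaches (suc s) | β-least (suc s)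
  ... | zero  | () | _
  ... | suc b | reaches | least = begin
    sum1 J (λ j → indicator (α p j ≤? s)) + 1
      ≡⟨ cong (_+ 1) (sum1-cong J (λ j _ _ → indicator-cong below above (α p j ≤? s) (j ≤? b))) ⟩
    sum1 J (λ j → indicator (j ≤? b)) + 1
      ≡⟨ cong (_+ 1) (trans (count-≤ J b) (m≥n⇒m⊓n≡n b≤J)) ⟩
    b + 1
      ≡⟨ +-comm b 1 ⟩
    suc b ∎
    where
    open ≡-Reasoning
    below : ∀ {j} → α p j ≤ s → j ≤ b
    below αj≤s = ≮⇒≥ λ b<j → <⇒≱ (s≤s αj≤s) (≤-trans reaches (α-mono b<j))
    above : ∀ {j} → j ≤ b → α p j ≤ s
    above j≤b = ≤-pred (least _ (s≤s j≤b))
    b≤J : b ≤ J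
    b≤J = ≮⇒≥ λ J<b → <⇒≱ (least J (m≤n⇒m≤1+n J<b)) s<αJ

  B-formula : ∀ s J → s ≤ α p J → s + sum1 J (λ j → s ∸ α p j) ≡ B p s
  B-formula zero    J _     = trans (sum1-cong J (λ j _ _ → 0∸n≡0 (α p j))) (sum1-zero J)
  B-formula (suc s) J s<αJ = begin
    suc s + sum1 J (λ j → suc s ∸ α p j)
      ≡⟨ cong (suc s +_) (trans (sum1-cong J (λ j _ _ → ∸-suc s (α p j))) (sum1-+ J _ _)) ⟩
    suc s + (X + Y)
      ≡⟨ regroup s X Y ⟩
    (s + X) + (Y + 1)
      ≡⟨ cong₂ _+_ (B-formula s J (≤-trans (n≤1+n s) s<αJ)) (count-α≤ s J s<αJ) ⟩
    B p s + β p (suc s) ∎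
    where
    open ≡-Reasoning
    X = sum1 J (λ j → s ∸ α p j)
    Y = sum1 J (λ j → indicator (α p j ≤? s))
    regroup : ∀ s x y → suc s + (x + y) ≡ (s + x) + (y + 1)
    regroup = solve-∀

-- Lists of integers modulo M 0, …, M (n-1) in their first n coordinates are enumerated,
-- one representative per class, by Fin (M 0 · M 1 ⋯ M (n-1)) via mixed-radix digits.
module Residues where
  open import Data.Nat as ℕ using (ℕ; zero; suc; NonZero; z≤n; s≤s; _<_; _∸_)
  open import Data.Nat.Properties as ℕ using (≤-total; ≤-antisym; m∸n≡0⇒m≤n; m∸n≤m; ≤-<-trans; <⇒≱)
  open import Data.Nat.Divisibility as ℕ using (∣⇒≤)
  open import Data.Integer using (ℤ; +_; _+_; _-_; _*_; -_; ∣_∣)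
  open import Data.Integer.Properties using (m-n≡m⊖n; ∣⊖∣-≤; ∣m⊖n∣≡∣n⊖m∣)
  open import Data.Integer.Divisibility.Signed using (_∣_; divides; ∣⇒∣ᵤ)
  open import Data.Integer.DivMod using (_%ℕ_; _/ℕ_; n%ℕd<d; a≡a%ℕn+[a/ℕn]*n)
  open import Data.Integer.Tactic.RingSolver using (solve-∀)
  open import Data.Fin as Fin using (Fin; toℕ; fromℕ<; remQuot; combine)
  open import Data.Fin.Properties using (remQuot-combine; combine-remQuot; toℕ-fromℕ<; toℕ-injective; toℕ<n)
  open import Data.List using (List; []; _∷_)
  open import Data.Product using (Σ; _,_; proj₁; proj₂)
  open import Data.Sum using (inj₁; inj₂)
  open import Data.Empty using (⊥-elim)
  open import Function using (_∘_)
  open import Relation.Binary.PropositionalEquality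
  open import Defs using (sum1)
  open Coefficients using (coeff)
  open Counting using (sum1-shift)

  prod : (ℕ → ℕ) → ℕ → ℕ
  prod M zero    = 1
  prod M (suc n) = M 0 ℕ.* prod (M ∘ suc) n

  prod-powers : ∀ b f J → prod (λ j → b ℕ.^ f (suc j)) J ≡ b ℕ.^ sum1 J f
  prod-powers b f zero    = refl
  prod-powers b f (suc J) = begin
    b ℕ.^ f 1 ℕ.* prod (λ j → b ℕ.^ f (suc (suc j))) J
      ≡⟨ cong (b ℕ.^ f 1 ℕ.*_) (prod-powers b (f ∘ suc) J) ⟩
    b ℕ.^ f 1 ℕ.* b ℕ.^ sum1 J (f ∘ suc)
      ≡⟨ ℕ.^-distribˡ-+-* b (f 1) _ ⟨
    b ℕ.^ (f 1 ℕ.+ sum1 J (f ∘ suc))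
      ≡⟨ cong (b ℕ.^_) (sum1-shift J f) ⟨
    b ℕ.^ sum1 (suc J) f ∎
    where open ≡-Reasoning

  Agree : (ℕ → ℕ) → ℕ → List ℤ → List ℤ → Set
  Agree M n a b = ∀ j → j < n → + M j ∣ coeff a j - coeff b j

  digits : ∀ M n → Fin (prod M n) → List ℤ
  digits M zero    i = []
  digits M (suc n) i = + toℕ (proj₁ split) ∷ digits (M ∘ suc) n (proj₂ split)
    where split = remQuot {M 0} (prod (M ∘ suc) n) i

  shift : List ℤ → List ℤ
  shift []       = []
  shift (_ ∷ cs) = cs

  coeff-shift : ∀ cs j → coeff (shift cs) j ≡ coeff cs (suc j)
  coeff-shift []       j = refl
  coeff-shift (c ∷ cs) j = refl

  remainder-congruent : ∀ x M .{{_ : NonZero M}} → + M ∣ + (x %ℕ M) - x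
  remainder-congruent x M =
    divides (- (x /ℕ M))
      (trans (cong (λ y → + (x %ℕ M) - y) (a≡a%ℕn+[a/ℕn]*n x M)) (cancel (+ (x %ℕ M)) (x /ℕ M) (+ M)))
    where
    cancel : ∀ r q m → r - (r + q * m) ≡ (- q) * m
    cancel = solve-∀

  small-multiple : ∀ {M d} → M ℕ.∣ d → d < M → d ≡ 0
  small-multiple {d = zero}  _   _   = refl
  small-multiple {d = suc d} M∣d d<M = ⊥-elim (<⇒≱ d<M (∣⇒≤ M∣d))

  residue-unique : ∀ {M a b} → a < M → b < M → + M ∣ + a - + b → a ≡ b
  residue-unique {M} {a} {b} a<M b<M M∣a-b with ≤-total a b
  ... | inj₁ a≤b = ≤-antisym a≤b (m∸n≡0⇒m≤n (small-multiple M∣b-a (≤-<-trans (m∸n≤m b a) b<M)))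
    where
    M∣b-a : M ℕ.∣ b ∸ a
    M∣b-a = subst (M ℕ.∣_) (trans (cong ∣_∣ (m-n≡m⊖n a b)) (∣⊖∣-≤ a≤b)) (∣⇒∣ᵤ M∣a-b)
  ... | inj₂ b≤a = ≤-antisym (m∸n≡0⇒m≤n (small-multiple M∣a-b′ (≤-<-trans (m∸n≤m a b) a<M))) b≤a
    where
    M∣a-b′ : M ℕ.∣ a ∸ b
    M∣a-b′ = subst (M ℕ.∣_) (trans (cong ∣_∣ (m-n≡m⊖n a b)) (trans (∣m⊖n∣≡∣n⊖m∣ a b) (∣⊖∣-≤ b≤a))) (∣⇒∣ᵤ M∣a-b)

  digits-surjective : ∀ M n → (∀ j → NonZero (M j)) →
                      ∀ a → Σ (Fin (prod M n)) λ i → Agree M n (digits M n i) a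
  digits-surjective M zero    nz a = Fin.zero , λ j ()
  digits-surjective M (suc n) nz a with digits-surjective (M ∘ suc) n (nz ∘ suc) (shift a)
  ... | q , agree-tail = combine r q , agree
    where
    instance _ = nz 0
    r : Fin (M 0)
    r = fromℕ< (n%ℕd<d (coeff a 0) (M 0))
    agree-head : + M 0 ∣ + toℕ r - coeff a 0
    agree-head = subst (λ x → + M 0 ∣ + x - coeff a 0) (sym (toℕ-fromℕ< _)) (remainder-congruent (coeff a 0) (M 0))
    agree : Agree M (suc n) (digits M (suc n) (combine r q)) a
    agree zero    _         =
      subst (λ d → + M 0 ∣ + toℕ (proj₁ d) - coeff a 0) (sym (remQuot-combine r q)) agree-head
    agree (suc j) (s≤s j<n) =
      subst (λ d → + M (suc j) ∣ coeff (digits (M ∘ suc) n (proj₂ d)) j - coeff a (suc j))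
            (sym (remQuot-combine r q))
            (subst (λ x → + M (suc j) ∣ coeff (digits (M ∘ suc) n q) j - x) (coeff-shift a j) (agree-tail j j<n))

  digits-injective : ∀ M n (i i′ : Fin (prod M n)) → Agree M n (digits M n i) (digits M n i′) → i ≡ i′
  digits-injective M zero    Fin.zero Fin.zero _     = refl
  digits-injective M (suc n) i        i′       agree = begin
    i                                     ≡⟨ combine-remQuot {M 0} (prod (M ∘ suc) n) i ⟨
    combine (proj₁ (split i)) (proj₂ (split i))   ≡⟨ cong₂ combine same-head same-tail ⟩
    combine (proj₁ (split i′)) (proj₂ (split i′)) ≡⟨ combine-remQuot {M 0} (prod (M ∘ suc) n) i′ ⟩
    i′                                    ∎
    where
    open ≡-Reasoning
    split = remQuot {M 0} (prod (M ∘ suc) n)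
    same-head : proj₁ (split i) ≡ proj₁ (split i′)
    same-head = toℕ-injective (residue-unique (toℕ<n _) (toℕ<n _) (agree 0 (s≤s z≤n)))
    same-tail : proj₂ (split i) ≡ proj₂ (split i′)
    same-tail = digits-injective (M ∘ suc) n _ _ (λ j j<n → agree (suc j) (s≤s j<n))

module Quotient (p : ℕ) .{{_ : NonZero p}} (p-prime : Prime p) (S s : ℕ) (s≤S : s ≤ S) where
  open import Data.Nat as ℕ using (zero; suc; _∸_; _^_; _!; _≤_; s≤s)
  open import Data.Nat.Properties as ℕ
    using (m≤n⇒m∸n≡0; ≤-trans; n≤1+n; ^-distribˡ-+-*; m^n≢0; m∸n+n≡m; +-assoc; ≮⇒≥)
  import Data.Nat.Divisibility as ℕ
  open import Data.Integer using (+_; 0ℤ; _*_; ∣_∣)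
  open import Data.Integer.Properties using (abs-*)
  open import Data.Integer.Divisibility.Signed using (_∣_; ∣ᵤ⇒∣; ∣⇒∣ᵤ; ∣-trans; ∣m⇒∣m*n)
  open import Data.Fin using (Fin)
  open import Data.Product using (Σ; _,_)
  open import Relation.Nullary using (yes; no)
  open import Relation.Binary.PropositionalEquality
  open import Defs using (Poly; α; B; sum1; InI; _≈[_,_,_]_; HasCard; _-ₚ_)
  open Legendre p p-prime
  open Coefficients using (coeff; coeff--ₚ)
  open FallingFactorial
  open Residues

  -- p^{E j} is the modulus of the j-th falling-factorial coefficient
  E : ℕ → ℕ
  E zero    = S
  E (suc j) = s ∸ α p (suc j)

  moduli : ℕ → ℕ
  moduli j = p ^ E j

  -- only the coefficients below K = p·s + 1 are constrained
  K : ℕ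
  K = suc (p ℕ.* s)

  E-trivial : ∀ j → K ≤ j → E j ≡ 0
  E-trivial (suc j) (s≤s ps≤j) = m≤n⇒m∸n≡0 (≤-trans (m≤α[p*m] s) (α-mono (≤-trans ps≤j (n≤1+n j))))

  legendre-ℤ⇒ : ∀ j c → + (p ^ s) ∣ c * + (j !) → + (p ^ (s ∸ α p j)) ∣ c
  legendre-ℤ⇒ j c d = ∣ᵤ⇒∣ (legendre-∣⇒ j s ∣ c ∣ (subst (p ^ s ℕ.∣_) (abs-* c (+ (j !))) (∣⇒∣ᵤ d)))

  legendre-ℤ⇐ : ∀ j c → + (p ^ (s ∸ α p j)) ∣ c → + (p ^ s) ∣ c * + (j !)
  legendre-ℤ⇐ j c d = ∣ᵤ⇒∣ (subst (p ^ s ℕ.∣_) (sym (abs-* c (+ (j !)))) (legendre-∣⇐ j s ∣ c ∣ (∣⇒∣ᵤ d)))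

  -- Membership criterion: if f = Σ cⱼ x^(j), then f ∈ I_{S,s} iff p^{E j} ∣ cⱼ for all j.
  -- For j = 0 the two conditions p^s ∣ c₀ and p^S ∣ c₀ = f(0) combine to p^S ∣ c₀ as s ≤ S.
  ideal⇒ : ∀ {f cs} → Expansion f cs → InI p S s f → ∀ j → + moduli j ∣ coeff cs j
  ideal⇒ {cs = cs} ef (values , at-0) zero    = subst (_ ∣_) (trans (value ef 0ℤ) (lin-at-0 cs)) (∣ᵤ⇒∣ at-0)
  ideal⇒ {cs = cs} ef (values , at-0) (suc j) =
    legendre-ℤ⇒ (suc j) (coeff cs (suc j))
      (values-divisible⇒ cs (λ x → subst (_ ∣_) (value ef x) (∣ᵤ⇒∣ (values x))) (suc j))

  ideal⇐ : ∀ {f cs} → Expansion f cs → (∀ j → + moduli j ∣ coeff cs j) → InI p S s f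
  ideal⇐ {cs = cs} ef h =
    (λ x → ∣⇒∣ᵤ (subst (_ ∣_) (sym (value ef x)) (values-divisible⇐ cs weighted x))) ,
    ∣⇒∣ᵤ (subst (_ ∣_) (sym (trans (value ef 0ℤ) (lin-at-0 cs))) (h 0))
    where
    weighted : ∀ j → + (p ^ s) ∣ coeff cs j * + (j !)
    weighted zero    = ∣m⇒∣m*n (+ 1) (∣-trans (∣ᵤ⇒∣ (p^-∣ s≤S)) (h 0))
    weighted (suc j) = legendre-ℤ⇐ (suc j) (coeff cs (suc j)) (h (suc j))

  congruent⇒agree : ∀ {f g cs ds} → Expansion f cs → Expansion g ds →
                    f ≈[ p , S , s ] g → Agree moduli K cs ds
  congruent⇒agree {cs = cs} {ds} ef eg f≈g j _ =
    subst (_ ∣_) (coeff--ₚ cs ds j) (ideal⇒ (expansion--ₚ ef eg) f≈g j)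

  agree⇒congruent : ∀ {f g cs ds} → Expansion f cs → Expansion g ds →
                    Agree moduli K cs ds → f ≈[ p , S , s ] g
  agree⇒congruent {cs = cs} {ds} ef eg agree = ideal⇐ (expansion--ₚ ef eg) every-coefficient
    where
    every-coefficient : ∀ j → + moduli j ∣ coeff (cs -ₚ ds) j
    every-coefficient j with j ℕ.<? K
    ... | yes j<K = subst (_ ∣_) (sym (coeff--ₚ cs ds j)) (agree j j<K)
    ... | no  j≮K = subst (λ e → + (p ^ e) ∣ _) (sym (E-trivial j (≮⇒≥ j≮K))) (∣ᵤ⇒∣ (ℕ.1∣ _))

  classes : HasCard Poly (λ f g → f ≈[ p , S , s ] g) (prod moduli K)
  classes = representative , surjective , injective
    where
    representative : Fin (prod moduli K) → Poly
    representative i = fromFall (digits moduli K i)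
    surjective : ∀ f → Σ (Fin (prod moduli K)) λ i → representative i ≈[ p , S , s ] f
    surjective f with digits-surjective moduli K (λ j → m^n≢0 p (E j)) (toFall f)
    ... | i , agree = i , agree⇒congruent (fromFall-expansion (digits moduli K i)) (toFall-expansion f) agree
    injective : ∀ i i′ → representative i ≈[ p , S , s ] representative i′ → i ≡ i′
    injective i i′ congruent =
      digits-injective moduli K i i′
        (congruent⇒agree
          (fromFall-expansion (digits moduli K i)) (fromFall-expansion (digits moduli K i′)) congruent)

  class-count : prod moduli K ≡ p ^ (S ∸ s ℕ.+ B p s)
  class-count = begin
    p ^ S ℕ.* prod (λ j → p ^ (s ∸ α p (suc j))) (p ℕ.* s)
      ≡⟨ cong (p ^ S ℕ.*_) (prod-powers p (λ j → s ∸ α p j) (p ℕ.* s)) ⟩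
    p ^ S ℕ.* p ^ total
      ≡⟨ ^-distribˡ-+-* p S total ⟨
    p ^ (S ℕ.+ total)
      ≡⟨ cong (λ e → p ^ (e ℕ.+ total)) (m∸n+n≡m s≤S) ⟨
    p ^ ((S ∸ s ℕ.+ s) ℕ.+ total)
      ≡⟨ cong (p ^_) (+-assoc (S ∸ s) s total) ⟩
    p ^ (S ∸ s ℕ.+ (s ℕ.+ total))
      ≡⟨ cong (λ e → p ^ (S ∸ s ℕ.+ e)) (B-formula s (p ℕ.* s) (m≤α[p*m] s)) ⟩
    p ^ (S ∸ s ℕ.+ B p s) ∎
    where
    open ≡-Reasoning
    total = sum1 (p ℕ.* s) (λ j → s ∸ α p j)

open import Defs
open import Data.Nat using (ℕ; _≤_; _∸_; _+_; _^_; NonZero)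
open import Data.Nat.Primality using (Prime)
open import Relation.Binary.PropositionalEquality using (subst)

lemma2 : (p : ℕ) .{{_ : NonZero p}} → Prime p → (S s : ℕ) → s ≤ S →
    HasCard Poly (λ f g → f ≈[ p , S , s ] g) (p ^ (S ∸ s + B p s))
lemma2 p p-prime S s s≤S = subst (HasCard Poly (λ f g → f ≈[ p , S , s ] g)) class-count classes
  where open Quotient p p-prime S s s≤S
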